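{- Let $(x_n^t)_{n\in\mathbb{Z},\,t\ge 0}$ be the rule 150 elementary cellular automaton started from a single seed ($x_n^0=1$ if $n=0$, $x_n^0=0$ otherwise, and $x_n^{t+1}=(x_{n-1}^t+x_n^t+x_{n+1}^t)\bmod 2$), and let $X(t)=\sum_{n\in\mathbb{Z}}x_n^t$. Define $\chi(0)=1$ and $\chi(n)=2\chi(n-1)-(-1)^n$ for $n\ge 1$. Then for all integers $n\ge 0$, $$\chi(n)=\left\lfloor \frac{2^{n+2}+1}{3}\right\rfloor \quad\text{and}\quad \chi(n)=X(2^n-1).$$
   Context: $\lfloor\cdot\rfloor$ denotes the floor function. -}

module Defs where

open import Data.Nat using (ℕ; zero; suc; _+_; _*_; _^_)
open import Data.Nat.DivMod using (_/_; _%_)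
open import Data.Integer as ℤ using (ℤ; +_; -[1+_])
open import Data.Bool using (Bool; true; false; _xor_; if_then_else_)
open import Data.List using (List; []; _∷_; map; upTo)
open import Data.Nat.ListAction using (sum)
open import Relation.Nullary.Decidable using (⌊_⌋)

x : ℕ → ℤ → Bool
x zero    n = ⌊ n ℤ.≟ + 0 ⌋
x (suc t) n = x t (n ℤ.- + 1) xor (x t n xor x t (n ℤ.+ + 1))

bit : Bool → ℕ
bit true  = 1
bit false = 0

-- At time t the configuration is supported in
-- [-t, t] (the rule has radius 1), so the sum over ℤ equals the finite
-- sum over n = -t, …, t, i.e. n = k - t for k = 0, …, 2t.
X : ℕ → ℕ
X t = sum (map (λ k → bit (x t (+ k ℤ.- + t))) (upTo (2 * t + 1)))

negOnePow : ℕ → ℤ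
negOnePow zero    = + 1
negOnePow (suc n) = ℤ.- negOnePow n

χ : ℕ → ℤ
χ zero    = + 1
χ (suc n) = + 2 ℤ.* χ n ℤ.- negOnePow (suc n)

{-# OPTIONS --safe #-}
-- Over GF(2) one step of rule 150 is multiplication by 1 + z + z⁻¹, and squaring is additive,
-- so the configuration at time 2s is the one at time s spread out onto the even cells. One more
-- step shows that the zero-padded row at time 2s+1 is the padded row at time s with the XOR of
-- every pair of neighbours inserted between them. Writing N(t) for the number of live cells and
-- D(t) for the number of neighbour changes in the padded row, this gives N(2s+1) = N(s) + D(s)
-- and D(2s+1) = 2 N(s), so along t = 2ⁿ − 1 the counts obey the Jacobsthal recurrence
-- J(n+2) = J(n+1) + 2 J(n), as does χ. Finally J(n+2) = J(n) + 2ⁿ gives J(n) = ⌊(2ⁿ + 1)/3⌋.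
module Submission where

open import Defs
open import Data.Nat using (ℕ; zero; suc; _+_; _*_; _^_; _∸_; _<_; _≤_; s≤s; NonZero)
open import Data.Nat.Properties
  using (+-comm; +-suc; +-identityʳ; *-suc; ≤-refl; m<n⇒m<1+n; m≤n⇒m≤n+o; m≤n⇒m≤o+n; m^n≢0)
open import Data.Nat.DivMod using (_/_; m*n/n≡m; +-distrib-/-∣ˡ)
open import Data.Nat.Divisibility using (divides-refl)
import Data.Nat.Tactic.RingSolver as ℕ-Ring
open import Data.Integer as ℤ using (ℤ; +_; -[1+_])
import Data.Integer.Properties as ℤ
import Data.Integer.Tactic.RingSolver as ℤ-Ring
open import Data.Bool using (Bool; true; false; _xor_)
open import Data.Bool.Properties using (xor-assoc; xor-same; xor-identityʳ)
open import Data.Bool.Solver using (module xor-∧-Solver)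
open import Data.List using (List; []; _∷_; [_]; _++_; map; applyUpTo; upTo)
open import Data.List.Properties using (map-∘; map-upTo)
open import Data.Nat.ListAction using (sum)
open import Data.Product using (_×_; _,_)
open import Relation.Binary.PropositionalEquality
  using (_≡_; refl; sym; trans; cong; cong₂; module ≡-Reasoning)
open ≡-Reasoning

xor-square : ∀ a b c d e →
  (a xor (b xor c)) xor ((b xor (c xor d)) xor (c xor (d xor e))) ≡ a xor (c xor e)
xor-square = solve 5 (λ a b c d e →
  (a :+ (b :+ c)) :+ ((b :+ (c :+ d)) :+ (c :+ (d :+ e))) := a :+ (c :+ e)) refl
  where open xor-∧-Solver

-- (1 + z + z⁻¹)² = 1 + z² + z⁻² over GF(2).
x-suc-suc : ∀ t n → x (2 + t) n ≡ x t (n ℤ.- + 2) xor (x t n xor x t (n ℤ.+ + 2))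
x-suc-suc t n = begin
    x (2 + t) n
  ≡⟨ cong₂ (λ u w → u xor (x (1 + t) n xor w)) left right ⟩
    (x t (n ℤ.- + 2) xor (x t (n ℤ.- + 1) xor x t n))
      xor ((x t (n ℤ.- + 1) xor (x t n xor x t (n ℤ.+ + 1)))
      xor (x t n xor (x t (n ℤ.+ + 1) xor x t (n ℤ.+ + 2))))
  ≡⟨ xor-square (x t (n ℤ.- + 2)) (x t (n ℤ.- + 1)) (x t n) (x t (n ℤ.+ + 1)) (x t (n ℤ.+ + 2)) ⟩
    x t (n ℤ.- + 2) xor (x t n xor x t (n ℤ.+ + 2))
  ∎
  where
  [n-1]-1≡n-2 : n ℤ.- + 1 ℤ.- + 1 ≡ n ℤ.- + 2
  [n-1]-1≡n-2 = ℤ-Ring.solve (n ∷ [])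
  [n-1]+1≡n : n ℤ.- + 1 ℤ.+ + 1 ≡ n
  [n-1]+1≡n = ℤ-Ring.solve (n ∷ [])
  [n+1]-1≡n : n ℤ.+ + 1 ℤ.- + 1 ≡ n
  [n+1]-1≡n = ℤ-Ring.solve (n ∷ [])
  [n+1]+1≡n+2 : n ℤ.+ + 1 ℤ.+ + 1 ≡ n ℤ.+ + 2
  [n+1]+1≡n+2 = ℤ-Ring.solve (n ∷ [])
  left : x (1 + t) (n ℤ.- + 1) ≡ x t (n ℤ.- + 2) xor (x t (n ℤ.- + 1) xor x t n)
  left = cong₂ (λ i j → x t i xor (x t (n ℤ.- + 1) xor x t j)) [n-1]-1≡n-2 [n-1]+1≡n
  right : x (1 + t) (n ℤ.+ + 1) ≡ x t n xor (x t (n ℤ.+ + 1) xor x t (n ℤ.+ + 2))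
  right = cong₂ (λ i j → x t i xor (x t (n ℤ.+ + 1) xor x t j)) [n+1]-1≡n [n+1]+1≡n+2

x-double-even : ∀ s m → x (2 * s) (+ 2 ℤ.* m) ≡ x s m
x-double-odd  : ∀ s m → x (2 * s) (+ 2 ℤ.* m ℤ.+ + 1) ≡ false

x-double-even zero (+ zero)  = refl
x-double-even zero (+ suc _) = refl
x-double-even zero -[1+ _ ]  = refl
x-double-even (suc s) m = begin
    x (2 * suc s) (+ 2 ℤ.* m)
  ≡⟨ cong (λ t → x t (+ 2 ℤ.* m)) (*-suc 2 s) ⟩
    x (2 + 2 * s) (+ 2 ℤ.* m)
  ≡⟨ x-suc-suc (2 * s) (+ 2 ℤ.* m) ⟩
    y (+ 2 ℤ.* m ℤ.- + 2) xor (y (+ 2 ℤ.* m) xor y (+ 2 ℤ.* m ℤ.+ + 2))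
  ≡⟨ cong₂ (λ i j → y i xor (y (+ 2 ℤ.* m) xor y j)) 2m-2≡2[m-1] 2m+2≡2[m+1] ⟩
    y (+ 2 ℤ.* (m ℤ.- + 1)) xor (y (+ 2 ℤ.* m) xor y (+ 2 ℤ.* (m ℤ.+ + 1)))
  ≡⟨ cong₂ _xor_ (x-double-even s (m ℤ.- + 1))
                 (cong₂ _xor_ (x-double-even s m) (x-double-even s (m ℤ.+ + 1))) ⟩
    x (suc s) m
  ∎
  where
  y : ℤ → Bool
  y = x (2 * s)
  2m-2≡2[m-1] : + 2 ℤ.* m ℤ.- + 2 ≡ + 2 ℤ.* (m ℤ.- + 1)
  2m-2≡2[m-1] = ℤ-Ring.solve (m ∷ [])
  2m+2≡2[m+1] : + 2 ℤ.* m ℤ.+ + 2 ≡ + 2 ℤ.* (m ℤ.+ + 1)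
  2m+2≡2[m+1] = ℤ-Ring.solve (m ∷ [])

x-double-odd zero (+ zero)       = refl
x-double-odd zero (+ suc _)      = refl
x-double-odd zero -[1+ zero ]    = refl
x-double-odd zero -[1+ suc _ ]   = refl
x-double-odd (suc s) m = begin
    x (2 * suc s) (2m+1)
  ≡⟨ cong (λ t → x t (2m+1)) (*-suc 2 s) ⟩
    x (2 + 2 * s) (2m+1)
  ≡⟨ x-suc-suc (2 * s) (2m+1) ⟩
    y (2m+1 ℤ.- + 2) xor (y 2m+1 xor y (2m+1 ℤ.+ + 2))
  ≡⟨ cong₂ (λ i j → y i xor (y 2m+1 xor y j)) [2m+1]-2≡2[m-1]+1 [2m+1]+2≡2[m+1]+1 ⟩
    y (+ 2 ℤ.* (m ℤ.- + 1) ℤ.+ + 1) xor (y 2m+1 xor y (+ 2 ℤ.* (m ℤ.+ + 1) ℤ.+ + 1))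
  ≡⟨ cong₂ _xor_ (x-double-odd s (m ℤ.- + 1))
                 (cong₂ _xor_ (x-double-odd s m) (x-double-odd s (m ℤ.+ + 1))) ⟩
    false
  ∎
  where
  y : ℤ → Bool
  y = x (2 * s)
  2m+1 : ℤ
  2m+1 = + 2 ℤ.* m ℤ.+ + 1
  [2m+1]-2≡2[m-1]+1 : + 2 ℤ.* m ℤ.+ + 1 ℤ.- + 2 ≡ + 2 ℤ.* (m ℤ.- + 1) ℤ.+ + 1
  [2m+1]-2≡2[m-1]+1 = ℤ-Ring.solve (m ∷ [])
  [2m+1]+2≡2[m+1]+1 : + 2 ℤ.* m ℤ.+ + 1 ℤ.+ + 2 ≡ + 2 ℤ.* (m ℤ.+ + 1) ℤ.+ + 1
  [2m+1]+2≡2[m+1]+1 = ℤ-Ring.solve (m ∷ [])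

x-suc-double-even : ∀ s m → x (suc (2 * s)) (+ 2 ℤ.* m) ≡ x s m
x-suc-double-even s m = begin
    y (+ 2 ℤ.* m ℤ.- + 1) xor (y (+ 2 ℤ.* m) xor y (+ 2 ℤ.* m ℤ.+ + 1))
  ≡⟨ cong (λ i → y i xor (y (+ 2 ℤ.* m) xor y (+ 2 ℤ.* m ℤ.+ + 1))) 2m-1≡2[m-1]+1 ⟩
    y (+ 2 ℤ.* (m ℤ.- + 1) ℤ.+ + 1) xor (y (+ 2 ℤ.* m) xor y (+ 2 ℤ.* m ℤ.+ + 1))
  ≡⟨ cong₂ _xor_ (x-double-odd s (m ℤ.- + 1)) (cong₂ _xor_ (x-double-even s m) (x-double-odd s m)) ⟩
    x s m xor false
  ≡⟨ xor-identityʳ (x s m) ⟩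
    x s m
  ∎
  where
  y : ℤ → Bool
  y = x (2 * s)
  2m-1≡2[m-1]+1 : + 2 ℤ.* m ℤ.- + 1 ≡ + 2 ℤ.* (m ℤ.- + 1) ℤ.+ + 1
  2m-1≡2[m-1]+1 = ℤ-Ring.solve (m ∷ [])

[2m+1]+1≡2[m+1] : ∀ m → + 2 ℤ.* m ℤ.+ + 1 ℤ.+ + 1 ≡ + 2 ℤ.* (m ℤ.+ + 1)
[2m+1]+1≡2[m+1] = ℤ-Ring.solve-∀

x-suc-double-odd : ∀ s m → x (suc (2 * s)) (+ 2 ℤ.* m ℤ.+ + 1) ≡ x s m xor x s (m ℤ.+ + 1)
x-suc-double-odd s m = begin
    y (2m+1 ℤ.- + 1) xor (y 2m+1 xor y (2m+1 ℤ.+ + 1))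
  ≡⟨ cong₂ (λ i j → y i xor (y 2m+1 xor y j)) [2m+1]-1≡2m ([2m+1]+1≡2[m+1] m) ⟩
    y (+ 2 ℤ.* m) xor (y 2m+1 xor y (+ 2 ℤ.* (m ℤ.+ + 1)))
  ≡⟨ cong₂ _xor_ (x-double-even s m)
                 (cong₂ _xor_ (x-double-odd s m) (x-double-even s (m ℤ.+ + 1))) ⟩
    x s m xor x s (m ℤ.+ + 1)
  ∎
  where
  y : ℤ → Bool
  y = x (2 * s)
  2m+1 : ℤ
  2m+1 = + 2 ℤ.* m ℤ.+ + 1
  [2m+1]-1≡2m : + 2 ℤ.* m ℤ.+ + 1 ℤ.- + 1 ≡ + 2 ℤ.* m
  [2m+1]-1≡2m = ℤ-Ring.solve (m ∷ [])

x-outside-right : ∀ {t n} → t < n → x t (+ n) ≡ false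
x-outside-right {zero}  {suc n} _         = refl
x-outside-right {suc t} {suc n} (s≤s t<n) =
  cong₂ _xor_ (x-outside-right t<n)
    (cong₂ _xor_ (x-outside-right (m<n⇒m<1+n t<n))
                 (x-outside-right (m≤n⇒m≤n+o 1 (m<n⇒m<1+n t<n))))

x-outside-left : ∀ {t n} → t ≤ n → x t -[1+ n ] ≡ false
x-outside-left {zero}  _         = refl
x-outside-left {suc t} {suc n} (s≤s t≤n) =
  cong₂ _xor_ (x-outside-left (m≤n⇒m≤o+n 2 (m≤n⇒m≤n+o 0 t≤n)))
    (cong₂ _xor_ (x-outside-left (m≤n⇒m≤o+n 1 t≤n)) (x-outside-left t≤n))

window : {A : Set} → (ℤ → A) → ℤ → ℕ → List A
window f a zero    = []
window f a (suc n) = f a ∷ window f (a ℤ.+ + 1) n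

window-∷ʳ : {A : Set} (f : ℤ → A) (a : ℤ) (n : ℕ) →
            window f a (suc n) ≡ window f a n ++ [ f (a ℤ.+ + n) ]
window-∷ʳ f a zero    = cong (λ i → [ f i ]) (sym (ℤ.+-identityʳ a))
window-∷ʳ f a (suc n) = cong (f a ∷_) (begin
    window f (a ℤ.+ + 1) (suc n)
  ≡⟨ window-∷ʳ f (a ℤ.+ + 1) n ⟩
    window f (a ℤ.+ + 1) n ++ [ f (a ℤ.+ + 1 ℤ.+ + n) ]
  ≡⟨ cong (λ i → window f (a ℤ.+ + 1) n ++ [ f i ]) (ℤ.+-assoc a (+ 1) (+ n)) ⟩
    window f (a ℤ.+ + 1) n ++ [ f (a ℤ.+ + suc n) ]
  ∎)

applyUpTo-window : {A : Set} {g : ℕ → A} (f : ℤ → A) (a : ℤ) (n : ℕ) →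
                   (∀ k → g k ≡ f (+ k ℤ.+ a)) → applyUpTo g n ≡ window f a n
applyUpTo-window f a zero    g≗f = refl
applyUpTo-window f a (suc n) g≗f =
  cong₂ _∷_ (trans (g≗f 0) (cong f (ℤ.+-identityˡ a)))
            (applyUpTo-window f (a ℤ.+ + 1) n (λ k → trans (g≗f (suc k)) (cong f (shift (+ k)))))
  where
  shift : ∀ i → + 1 ℤ.+ i ℤ.+ a ≡ i ℤ.+ (a ℤ.+ + 1)
  shift i = ℤ-Ring.solve (i ∷ a ∷ [])

ones : List Bool → ℕ
ones l = sum (map bit l)

changes : List Bool → ℕ
changes (p ∷ q ∷ l) = bit (p xor q) + changes (q ∷ l)
changes _           = 0

refine : List Bool → List Bool
refine (p ∷ q ∷ l) = p ∷ (p xor q) ∷ refine (q ∷ l)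
refine l           = l

ones-∷ʳ-false : ∀ l → ones (l ++ [ false ]) ≡ ones l
ones-∷ʳ-false []      = refl
ones-∷ʳ-false (b ∷ l) = cong (_+_ (bit b)) (ones-∷ʳ-false l)

ones-refine : ∀ l → ones (refine l) ≡ ones l + changes l
ones-refine []          = refl
ones-refine (p ∷ [])    = sym (+-identityʳ _)
ones-refine (p ∷ q ∷ l) = begin
    bit p + (bit (p xor q) + ones (refine (q ∷ l)))
  ≡⟨ cong (λ n → bit p + (bit (p xor q) + n)) (ones-refine (q ∷ l)) ⟩
    bit p + (bit (p xor q) + (ones (q ∷ l) + changes (q ∷ l)))
  ≡⟨ interchange (bit p) (bit (p xor q)) (ones (q ∷ l)) (changes (q ∷ l)) ⟩
    (bit p + ones (q ∷ l)) + (bit (p xor q) + changes (q ∷ l))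
  ∎
  where
  interchange : ∀ a b c d → a + (b + (c + d)) ≡ (a + c) + (b + d)
  interchange = ℕ-Ring.solve-∀

changes-∷-refine : ∀ p q l →
                   changes (p ∷ refine (q ∷ l)) ≡ bit (p xor q) + changes (refine (q ∷ l))
changes-∷-refine p q []      = refl
changes-∷-refine p q (_ ∷ _) = refl

changes-refine : ∀ p l → changes (refine (p ∷ l ++ [ false ])) ≡ bit p + 2 * ones l
changes-refine false []      = refl
changes-refine true  []      = refl
changes-refine p     (q ∷ l) = begin
    bit (p xor (p xor q)) + changes ((p xor q) ∷ refine (q ∷ l ++ [ false ]))
  ≡⟨ cong (_+_ (bit (p xor (p xor q)))) (changes-∷-refine (p xor q) q (l ++ [ false ])) ⟩
    bit (p xor (p xor q)) + (bit ((p xor q) xor q) + changes (refine (q ∷ l ++ [ false ])))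
  ≡⟨ cong₂ (λ u v → bit u + (bit v + changes (refine (q ∷ l ++ [ false ])))) p⊕[p⊕q]≡q [p⊕q]⊕q≡p ⟩
    bit q + (bit p + changes (refine (q ∷ l ++ [ false ])))
  ≡⟨ cong (λ n → bit q + (bit p + n)) (changes-refine q l) ⟩
    bit q + (bit p + (bit q + 2 * ones l))
  ≡⟨ rearrange (bit p) (bit q) (ones l) ⟩
    bit p + 2 * (bit q + ones l)
  ∎
  where
  p⊕[p⊕q]≡q : p xor (p xor q) ≡ q
  p⊕[p⊕q]≡q = trans (sym (xor-assoc p p q)) (cong (_xor q) (xor-same p))
  [p⊕q]⊕q≡p : (p xor q) xor q ≡ p
  [p⊕q]⊕q≡p = trans (xor-assoc p q q) (trans (cong (p xor_) (xor-same q)) (xor-identityʳ p))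
  rearrange : ∀ a b c → b + (a + (b + 2 * c)) ≡ a + 2 * (b + c)
  rearrange = ℕ-Ring.solve-∀

window-refine : ∀ s m k →
  window (x (suc (2 * s))) (+ 2 ℤ.* m) (suc (2 * k)) ≡ refine (window (x s) m (suc k))
window-refine s m zero    = cong [_] (x-suc-double-even s m)
window-refine s m (suc k) = begin
    window (x (suc (2 * s))) (+ 2 ℤ.* m) (suc (2 * suc k))
  ≡⟨ cong (λ n → window (x (suc (2 * s))) (+ 2 ℤ.* m) (suc n)) (*-suc 2 k) ⟩
    x (suc (2 * s)) (+ 2 ℤ.* m) ∷ x (suc (2 * s)) (+ 2 ℤ.* m ℤ.+ + 1)
      ∷ window (x (suc (2 * s))) (+ 2 ℤ.* m ℤ.+ + 1 ℤ.+ + 1) (suc (2 * k))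
  ≡⟨ cong₂ _∷_ (x-suc-double-even s m) (cong₂ _∷_ (x-suc-double-odd s m)
       (cong (λ i → window (x (suc (2 * s))) i (suc (2 * k))) ([2m+1]+1≡2[m+1] m))) ⟩
    x s m ∷ (x s m xor x s (m ℤ.+ + 1)) ∷ window (x (suc (2 * s))) (+ 2 ℤ.* (m ℤ.+ + 1)) (suc (2 * k))
  ≡⟨ cong (λ l → x s m ∷ (x s m xor x s (m ℤ.+ + 1)) ∷ l) (window-refine s (m ℤ.+ + 1) k) ⟩
    refine (window (x s) m (suc (suc k)))
  ∎

row : ℕ → List Bool
row t = window (x t) (ℤ.- + t) (suc (2 * t))

paddedRow : ℕ → List Bool
paddedRow t = window (x t) -[1+ t ] (3 + 2 * t)

paddedRow-refine : ∀ s → paddedRow (suc (2 * s)) ≡ refine (paddedRow s)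
paddedRow-refine s =
  trans (cong₂ (window (x (suc (2 * s)))) start length) (window-refine s -[1+ s ] (2 + 2 * s))
  where
  start : -[1+ suc (2 * s) ] ≡ + 2 ℤ.* -[1+ s ]
  start = cong -[1+_] (sym (+-suc s (s + 0)))
  length : 3 + 2 * suc (2 * s) ≡ suc (2 * (2 + 2 * s))
  length = ℕ-Ring.solve (s ∷ [])

paddedRow≡false∷row++[false] : ∀ t → paddedRow t ≡ false ∷ row t ++ [ false ]
paddedRow≡false∷row++[false] t = begin
    x t -[1+ t ] ∷ window (x t) (-[1+ t ] ℤ.+ + 1) (suc (suc (2 * t)))
  ≡⟨ cong₂ _∷_ (x-outside-left {t} ≤-refl) (cong (λ a → window (x t) a (suc (suc (2 * t)))) left-end) ⟩
    false ∷ window (x t) (ℤ.- + t) (suc (suc (2 * t)))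
  ≡⟨ cong (false ∷_) (window-∷ʳ (x t) (ℤ.- + t) (suc (2 * t))) ⟩
    false ∷ row t ++ [ x t (ℤ.- + t ℤ.+ + suc (2 * t)) ]
  ≡⟨ cong (λ i → false ∷ row t ++ [ x t i ]) right-end ⟩
    false ∷ row t ++ [ x t (+ suc t) ]
  ≡⟨ cong (λ b → false ∷ row t ++ [ b ]) (x-outside-right {t} ≤-refl) ⟩
    false ∷ row t ++ [ false ]
  ∎
  where
  left-end : -[1+ t ] ℤ.+ + 1 ≡ ℤ.- + t
  left-end = trans (ℤ.+-comm -[1+ t ] (+ 1)) (ℤ.1-[1+n]≡-n t)
  1+2t≡t+[1+t] : suc (2 * t) ≡ t + suc t
  1+2t≡t+[1+t] = ℕ-Ring.solve (t ∷ [])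
  right-end : ℤ.- + t ℤ.+ + suc (2 * t) ≡ + suc t
  right-end = begin
      ℤ.- + t ℤ.+ + suc (2 * t)
    ≡⟨ ℤ.-m+n≡n⊖m t (suc (2 * t)) ⟩
      suc (2 * t) ℤ.⊖ t
    ≡⟨ cong₂ ℤ._⊖_ 1+2t≡t+[1+t] (sym (+-identityʳ t)) ⟩
      (t + suc t) ℤ.⊖ (t + 0)
    ≡⟨ ℤ.+-cancelˡ-⊖ t (suc t) 0 ⟩
      + suc t
    ∎

X≡ones-row : ∀ t → X t ≡ ones (row t)
X≡ones-row t = begin
    sum (map (λ k → bit (x t (+ k ℤ.- + t))) (upTo (2 * t + 1)))
  ≡⟨ cong sum (map-∘ (upTo (2 * t + 1))) ⟩
    ones (map (λ k → x t (+ k ℤ.- + t)) (upTo (2 * t + 1)))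
  ≡⟨ cong ones (map-upTo _ (2 * t + 1)) ⟩
    ones (applyUpTo (λ k → x t (+ k ℤ.- + t)) (2 * t + 1))
  ≡⟨ cong ones (applyUpTo-window (x t) (ℤ.- + t) (2 * t + 1) (λ _ → refl)) ⟩
    ones (window (x t) (ℤ.- + t) (2 * t + 1))
  ≡⟨ cong (λ n → ones (window (x t) (ℤ.- + t) n)) (+-comm (2 * t) 1) ⟩
    ones (row t)
  ∎

ones-paddedRow : ∀ t → ones (paddedRow t) ≡ X t
ones-paddedRow t = begin
    ones (paddedRow t)
  ≡⟨ cong ones (paddedRow≡false∷row++[false] t) ⟩
    ones (row t ++ [ false ])
  ≡⟨ ones-∷ʳ-false (row t) ⟩
    ones (row t)
  ≡⟨ X≡ones-row t ⟨
    X t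
  ∎

X-suc-double : ∀ s → X (suc (2 * s)) ≡ X s + changes (paddedRow s)
X-suc-double s = begin
    X (suc (2 * s))
  ≡⟨ ones-paddedRow (suc (2 * s)) ⟨
    ones (paddedRow (suc (2 * s)))
  ≡⟨ cong ones (paddedRow-refine s) ⟩
    ones (refine (paddedRow s))
  ≡⟨ ones-refine (paddedRow s) ⟩
    ones (paddedRow s) + changes (paddedRow s)
  ≡⟨ cong (_+ changes (paddedRow s)) (ones-paddedRow s) ⟩
    X s + changes (paddedRow s)
  ∎

changes-paddedRow-suc-double : ∀ s → changes (paddedRow (suc (2 * s))) ≡ 2 * X s
changes-paddedRow-suc-double s = begin
    changes (paddedRow (suc (2 * s)))
  ≡⟨ cong changes (paddedRow-refine s) ⟩
    changes (refine (paddedRow s))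
  ≡⟨ cong (λ l → changes (refine l)) (paddedRow≡false∷row++[false] s) ⟩
    changes (refine (false ∷ row s ++ [ false ]))
  ≡⟨ changes-refine false (row s) ⟩
    2 * ones (row s)
  ≡⟨ cong (2 *_) (X≡ones-row s) ⟨
    2 * X s
  ∎

X-recurrence : ∀ s → X (suc (2 * suc (2 * s))) ≡ X (suc (2 * s)) + 2 * X s
X-recurrence s =
  trans (X-suc-double (suc (2 * s))) (cong (_+_ (X (suc (2 * s)))) (changes-paddedRow-suc-double s))

jacobsthal : ℕ → ℕ
jacobsthal 0             = 0
jacobsthal 1             = 1
jacobsthal (suc (suc n)) = jacobsthal (suc n) + 2 * jacobsthal n

jacobsthal-+-suc : ∀ n → jacobsthal n + jacobsthal (suc n) ≡ 2 ^ n
jacobsthal-+-suc zero    = refl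
jacobsthal-+-suc (suc n) = begin
    jacobsthal (suc n) + (jacobsthal (suc n) + 2 * jacobsthal n)
  ≡⟨ double-sum (jacobsthal n) (jacobsthal (suc n)) ⟩
    2 * (jacobsthal n + jacobsthal (suc n))
  ≡⟨ cong (2 *_) (jacobsthal-+-suc n) ⟩
    2 * 2 ^ n
  ∎
  where
  double-sum : ∀ a b → b + (b + 2 * a) ≡ 2 * (a + b)
  double-sum = ℕ-Ring.solve-∀

jacobsthal-suc-suc : ∀ n → jacobsthal (2 + n) ≡ 2 ^ n + jacobsthal n
jacobsthal-suc-suc n = begin
    jacobsthal (suc n) + 2 * jacobsthal n
  ≡⟨ regroup (jacobsthal n) (jacobsthal (suc n)) ⟩
    (jacobsthal n + jacobsthal (suc n)) + jacobsthal n
  ≡⟨ cong (_+ jacobsthal n) (jacobsthal-+-suc n) ⟩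
    2 ^ n + jacobsthal n
  ∎
  where
  regroup : ∀ a b → b + 2 * a ≡ (a + b) + a
  regroup = ℕ-Ring.solve-∀

jacobsthal≡[2^n+1]/3 : ∀ n → jacobsthal n ≡ (2 ^ n + 1) / 3
jacobsthal≡[2^n+1]/3 0             = refl
jacobsthal≡[2^n+1]/3 1             = refl
jacobsthal≡[2^n+1]/3 (suc (suc n)) = begin
    jacobsthal (2 + n)
  ≡⟨ jacobsthal-suc-suc n ⟩
    2 ^ n + jacobsthal n
  ≡⟨ cong₂ _+_ (sym (m*n/n≡m (2 ^ n) 3)) (jacobsthal≡[2^n+1]/3 n) ⟩
    2 ^ n * 3 / 3 + (2 ^ n + 1) / 3
  ≡⟨ +-distrib-/-∣ˡ (2 ^ n + 1) (divides-refl (2 ^ n)) ⟨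
    (2 ^ n * 3 + (2 ^ n + 1)) / 3
  ≡⟨ cong (_/ 3) (split (2 ^ n)) ⟩
    (2 ^ (2 + n) + 1) / 3
  ∎
  where
  split : ∀ p → p * 3 + (p + 1) ≡ 2 * (2 * p) + 1
  split = ℕ-Ring.solve-∀

χ-suc-suc : ∀ n → χ (2 + n) ≡ χ (1 + n) ℤ.+ + 2 ℤ.* χ n
χ-suc-suc n = unfold (χ n) (negOnePow n)
  where
  unfold : ∀ c e →
           + 2 ℤ.* (+ 2 ℤ.* c ℤ.- ℤ.- e) ℤ.- ℤ.- ℤ.- e ≡ (+ 2 ℤ.* c ℤ.- ℤ.- e) ℤ.+ + 2 ℤ.* c
  unfold = ℤ-Ring.solve-∀

χ≡jacobsthal : ∀ n → χ n ≡ + jacobsthal (2 + n)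
χ≡jacobsthal 0             = refl
χ≡jacobsthal 1             = refl
χ≡jacobsthal (suc (suc n)) = begin
    χ (2 + n)
  ≡⟨ χ-suc-suc n ⟩
    χ (1 + n) ℤ.+ + 2 ℤ.* χ n
  ≡⟨ cong₂ (λ a b → a ℤ.+ + 2 ℤ.* b) (χ≡jacobsthal (suc n)) (χ≡jacobsthal n) ⟩
    + jacobsthal (3 + n) ℤ.+ + 2 ℤ.* + jacobsthal (2 + n)
  ≡⟨ pos-+-2* (jacobsthal (3 + n)) (jacobsthal (2 + n)) ⟨
    + jacobsthal (4 + n)
  ∎
  where
  pos-+-2* : ∀ a b → + (a + 2 * b) ≡ + a ℤ.+ + 2 ℤ.* + b
  pos-+-2* a b = trans (ℤ.pos-+ a (2 * b)) (cong (ℤ._+_ (+ a)) (ℤ.pos-* 2 b))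

2*n∸1 : ∀ n .{{_ : NonZero n}} → 2 * n ∸ 1 ≡ suc (2 * (n ∸ 1))
2*n∸1 (suc k) = +-suc k (k + 0)

2^[1+n]∸1 : ∀ n → 2 ^ suc n ∸ 1 ≡ suc (2 * (2 ^ n ∸ 1))
2^[1+n]∸1 n = 2*n∸1 (2 ^ n) {{m^n≢0 2 n}}

X[2^n∸1]≡jacobsthal : ∀ n → X (2 ^ n ∸ 1) ≡ jacobsthal (2 + n)
X[2^n∸1]≡jacobsthal 0             = refl
X[2^n∸1]≡jacobsthal 1             = refl
X[2^n∸1]≡jacobsthal (suc (suc n)) = begin
    X (2 ^ (2 + n) ∸ 1)
  ≡⟨ cong X (trans (2^[1+n]∸1 (suc n)) (cong (λ t → suc (2 * t)) (2^[1+n]∸1 n))) ⟩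
    X (suc (2 * suc (2 * (2 ^ n ∸ 1))))
  ≡⟨ X-recurrence (2 ^ n ∸ 1) ⟩
    X (suc (2 * (2 ^ n ∸ 1))) + 2 * X (2 ^ n ∸ 1)
  ≡⟨ cong₂ (λ a b → a + 2 * b)
       (trans (cong X (sym (2^[1+n]∸1 n))) (X[2^n∸1]≡jacobsthal (suc n))) (X[2^n∸1]≡jacobsthal n) ⟩
    jacobsthal (3 + n) + 2 * jacobsthal (2 + n)
  ∎

mainTheorem2 : (n : ℕ) →
    (χ n ≡ + ((2 ^ (n + 2) + 1) / 3)) × (χ n ≡ + X (2 ^ n ∸ 1))
mainTheorem2 n =
  trans (χ≡jacobsthal n) (cong +_ jacobsthal≡floor) ,
  trans (χ≡jacobsthal n) (cong +_ (sym (X[2^n∸1]≡jacobsthal n)))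
  where
  jacobsthal≡floor : jacobsthal (2 + n) ≡ (2 ^ (n + 2) + 1) / 3
  jacobsthal≡floor = trans (jacobsthal≡[2^n+1]/3 (2 + n)) (cong (λ k → (2 ^ k + 1) / 3) (+-comm 2 n))
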